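{- Let $(\mathcal{E},\mathbb{S})$ be a set system with $\mathcal{E}$ finite and $\mathbb{S}\subseteq 2^{\mathcal{E}}$, and let $<$ be a total order on $\mathcal{E}$. Then $\mathbb{S}$ is a supersolvable convex geometry with respect to $<$ if and only if $\mathbb{S}$ is the collection of closed sets of a closure operator on $\mathcal{E}$ that is supersolvable with respect to $<$.
   Context: A closure operator on $\mathcal{E}$ is $\sigma:2^{\mathcal{E}}\to2^{\mathcal{E}}$ with $A\subseteq\sigma(A)$, $A\subseteq B\Rightarrow\sigma(A)\subseteq\sigma(B)$, and $\sigma(\sigma(A))=\sigma(A)$; $A$ is closed if $\sigma(A)=A$. A closure operator $\sigma$ is supersolvable with respect to $<$ if for every closed set $A$ and every $e\in\mathcal{E}\setminus A$, every $f\in\sigma(A\cup\{e\})\setminus(A\cup\{e\})$ satisfies $e<f$. A set system $(\mathcal{E},\mathbb{S})$ is a supersolvable convex geometry with respect to $<$ if (1) $\mathcal{E}\in\mathbb{S}$, and (2) for every $A,B\in\mathbb{S}$ with $A\not\subseteq B$, letting $e=\min_<(A\setminus B)$, we have $A\setminus\{e\}\in\mathbb{S}$. -}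

module Defs where

open import Data.Nat using (ℕ)
open import Data.Fin using (Fin)
open import Data.Fin.Subset using (Subset; _∈_; _∉_; _⊆_; _∪_; _-_; ⁅_⁆; ⊤)
open import Data.Bool using (Bool; true)
open import Data.Product using (_×_)
open import Data.Sum using (_⊎_)
open import Relation.Binary.PropositionalEquality using (_≡_)
open import Relation.Binary.Core using (Rel)
open import Level using (0ℓ)

-- Ground set ℰ = Fin n (an arbitrary finite set); subsets are Subset n.
-- A set system 𝕊 ⊆ 2^ℰ is given by its characteristic function.
SetSystem : ℕ → Set
SetSystem n = Subset n → Bool

_∈𝕊_ : ∀ {n} → Subset n → SetSystem n → Set
A ∈𝕊 S = S A ≡ true

record IsClosureOperator {n : ℕ} (σ : Subset n → Subset n) : Set where
  field
    extensive  : ∀ A → A ⊆ σ A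
    monotone   : ∀ A B → A ⊆ B → σ A ⊆ σ B
    idempotent : ∀ A → σ (σ A) ≡ σ A

Closed : ∀ {n} → (Subset n → Subset n) → Subset n → Set
Closed σ A = σ A ≡ A

SupersolvableClosure : ∀ {n} → Rel (Fin n) 0ℓ → (Subset n → Subset n) → Set
SupersolvableClosure {n} _<_ σ =
  ∀ (A : Subset n) → Closed σ A →
  ∀ (e : Fin n) → e ∉ A →
  ∀ (f : Fin n) → f ∈ σ (A ∪ ⁅ e ⁆) → f ∉ A ∪ ⁅ e ⁆ → e < f

IsMinDiff : ∀ {n} → Rel (Fin n) 0ℓ → Subset n → Subset n → Fin n → Set
IsMinDiff _<_ A B e =
  e ∈ A × e ∉ B × (∀ x → x ∈ A → x ∉ B → e ≡ x ⊎ e < x)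

record IsSupersolvableConvexGeometry {n : ℕ} (_<_ : Rel (Fin n) 0ℓ)
         (S : SetSystem n) : Set where
  field
    full-mem : ⊤ ∈𝕊 S
    remove-min : ∀ A B → A ∈𝕊 S → B ∈𝕊 S →
      ∀ e → IsMinDiff _<_ A B e → (A - e) ∈𝕊 S

{-# OPTIONS --safe #-}
-- A supersolvable convex geometry is closed under ∩, since A ∩ B is reached from A by repeatedly
-- removing min (A ─ B); so it is the family of closed sets of σ A = ⋂ {X ∈ 𝕊 ∣ A ⊆ X}. Removing
-- from σ (A ∪ ⁅e⁆) the elements outside A in increasing order, up to some f < e, yields a member
-- of 𝕊 containing A ∪ ⁅e⁆ but not f, so σ adds nothing below e.
-- Conversely, for closed A, B and e = min (A ─ B), grow A ∩ B inside A by closing under one new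
-- element x ≠ e at a time: by supersolvability e could only appear if x < e, which minimality of
-- e forbids, so the growth ends at the closed set A - e.
module Submission where

open import Defs
open import Data.Nat using (ℕ)
open import Data.Fin using (Fin)
open import Data.Fin.Subset using (Subset)
open import Data.Product using (Σ; _×_)
open import Relation.Binary.Core using (Rel)
open import Relation.Binary.Structures using (IsStrictTotalOrder)
open import Relation.Binary.PropositionalEquality using (_≡_)
open import Function.Bundles using (_⇔_)
open import Level using (0ℓ)

open import Data.Bool.Base using (true)
open import Data.Bool.Properties using () renaming (_≟_ to _≟ᵇ_)
open import Data.Empty using (⊥-elim)
open import Data.Fin.Subset
  using (_∈_; _∉_; _⊆_; _⊂_; _⊃_; _∪_; _∩_; _─_; _-_; ⁅_⁆; ⊤)
open import Data.Fin.Subset.Induction using (Acc; acc; ⊂-wellFounded; ⊃-wellFounded)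
open import Data.Fin.Subset.Properties
  using ( _∈?_; _⊆?_; _⊂?_; anySubset?; ⊆-antisym; ⊆⊤; p⊆p∪q; q⊆p∪q; x∈p∪q⁻; x∈p∩q⁺
        ; p∩q⊆p; p∩q⊆q; x∈⁅x⁆; x∈⁅y⁆⇒x≡y; p─q⊆p; x∈p∧x≢y⇒x∈p-y; x∈p⇒p-x⊂p)
open import Data.List.Base using (List; []; _∷_; allFin)
open import Data.List.Membership.Propositional using () renaming (_∈_ to _∈ₗ_)
open import Data.List.Membership.Propositional.Properties using (∈-allFin)
open import Data.List.Relation.Unary.Any as Any using ()
open import Data.Product using (∃; _,_; proj₁; proj₂)
open import Data.Sum using (_⊎_; inj₁; inj₂; [_,_]′)
open import Data.Unit using (tt)
open import Data.Vec.Base using (_∷_; there)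
open import Function.Base using (_∘_; id)
open import Function.Bundles using (mk⇔; Equivalence)
open import Relation.Binary.Definitions using (tri<; tri≈; tri>)
open import Relation.Binary.PropositionalEquality using (_≢_; refl; sym; subst)
open import Relation.Nullary using (¬_; yes; no; ¬?; decidable-stable)
open import Relation.Nullary.Decidable using (_×-dec_)
open import Relation.Unary using (Pred; Decidable; U)

x∈p─q⇒x∉q : ∀ {n} {x : Fin n} {p q : Subset n} → x ∈ p ─ q → x ∉ q
x∈p─q⇒x∉q {p = _ ∷ p} {_ ∷ q} (there x∈p─q) (there x∈q) = x∈p─q⇒x∉q {p = p} x∈p─q x∈q

x∈p-y⇒x≢y : ∀ {n} {x y : Fin n} {p : Subset n} → x ∈ p - y → x ≢ y
x∈p-y⇒x≢y {y = y} x∈p-y refl = x∈p─q⇒x∉q x∈p-y (x∈⁅x⁆ y)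

x∉p∧x≢y⇒x∉p∪⁅y⁆ : ∀ {n} {x y : Fin n} {p : Subset n} → x ∉ p → x ≢ y → x ∉ p ∪ ⁅ y ⁆
x∉p∧x≢y⇒x∉p∪⁅y⁆ {y = y} {p} x∉p x≢y = [ x∉p , x≢y ∘ x∈⁅y⁆⇒x≡y y ]′ ∘ x∈p∪q⁻ p ⁅ y ⁆

p⊆r∧x∈r⇒p∪⁅x⁆⊆r : ∀ {n} {x : Fin n} {p r : Subset n} → p ⊆ r → x ∈ r → p ∪ ⁅ x ⁆ ⊆ r
p⊆r∧x∈r⇒p∪⁅x⁆⊆r {x = x} {p} {r} p⊆r x∈r y∈p∪⁅x⁆ =
  [ p⊆r , (λ y∈⁅x⁆ → subst (_∈ r) (sym (x∈⁅y⁆⇒x≡y x y∈⁅x⁆)) x∈r) ]′ (x∈p∪q⁻ p ⁅ x ⁆ y∈p∪⁅x⁆)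

module Minimum {a ℓ} {X : Set a} {_<_ : Rel X ℓ} (sto : IsStrictTotalOrder _≡_ _<_) where
  open IsStrictTotalOrder sto using (compare; trans)

  _≼_ : Rel X _
  m ≼ x = m ≡ x ⊎ m < x

  <-≼-trans : ∀ {x y z} → x < y → y ≼ z → x < z
  <-≼-trans x<y (inj₁ refl) = x<y
  <-≼-trans x<y (inj₂ y<z)  = trans x<y y<z

  LowerBoundIn : ∀ {p} → Pred X p → List X → X → Set _
  LowerBoundIn P xs m = ∀ {x} → x ∈ₗ xs → P x → m ≼ x

  lowerBound-∷ : ∀ {p} {P : Pred X p} {x xs m} →
                 (P x → m ≼ x) → LowerBoundIn P xs m → LowerBoundIn P (x ∷ xs) m
  lowerBound-∷ m≼x m≼xs (Any.here refl) = m≼x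
  lowerBound-∷ m≼x m≼xs (Any.there y∈xs) = m≼xs y∈xs

  least? : ∀ {p} {P : Pred X p} → Decidable P → ∀ xs →
           (∃ λ m → P m × LowerBoundIn P xs m) ⊎ (∀ {x} → x ∈ₗ xs → ¬ P x)
  least? P? [] = inj₂ λ ()
  least? P? (x ∷ xs) with P? x | least? P? xs
  ... | no ¬Px | inj₂ none = inj₂ λ { (Any.here refl) → ¬Px ; (Any.there y∈xs) → none y∈xs }
  ... | no ¬Px | inj₁ (m , Pm , m≼) = inj₁ (m , Pm , lowerBound-∷ (⊥-elim ∘ ¬Px) m≼)
  ... | yes Px | inj₂ none =
    inj₁ (x , Px , lowerBound-∷ (λ _ → inj₁ refl) (λ y∈xs → ⊥-elim ∘ none y∈xs))
  ... | yes Px | inj₁ (m , Pm , m≼) with compare x m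
  ...   | tri< x<m _ _ =
    inj₁ (x , Px , lowerBound-∷ (λ _ → inj₁ refl) (λ y∈xs → inj₂ ∘ <-≼-trans x<m ∘ m≼ y∈xs))
  ...   | tri≈ _ refl _ = inj₁ (m , Pm , lowerBound-∷ (λ _ → inj₁ refl) m≼)
  ...   | tri> _ _ m<x = inj₁ (m , Pm , lowerBound-∷ (λ _ → inj₂ m<x) m≼)

⊆-or-minDiff : ∀ {n} {_<_ : Rel (Fin n) 0ℓ} → IsStrictTotalOrder _≡_ _<_ →
               (A B : Subset n) → A ⊆ B ⊎ ∃ (IsMinDiff _<_ A B)
⊆-or-minDiff {n} sto A B with Minimum.least? sto (λ x → x ∈? A ×-dec ¬? (x ∈? B)) (allFin n)
... | inj₁ (m , (m∈A , m∉B) , m≼) = inj₂ (m , m∈A , m∉B , λ x x∈A x∉B → m≼ (∈-allFin x) (x∈A , x∉B))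
... | inj₂ none = inj₁ λ {x} x∈A → decidable-stable (x ∈? B) λ x∉B → none (∈-allFin x) (x∈A , x∉B)

module Hull {n} (S : SetSystem n) (⊤∈𝕊 : ⊤ ∈𝕊 S)
            (∩∈𝕊 : ∀ {A B} → A ∈𝕊 S → B ∈𝕊 S → (A ∩ B) ∈𝕊 S) where

  LeastAbove : Subset n → Subset n → Set
  LeastAbove A X = X ∈𝕊 S × A ⊆ X × (∀ {Z} → Z ∈𝕊 S → A ⊆ Z → X ⊆ Z)

  leastAbove : ∀ A → ∃ (LeastAbove A)
  leastAbove A = descend ⊤ (⊂-wellFounded ⊤) ⊤∈𝕊 ⊆⊤
    where
    SmallerAbove : Subset n → Pred (Subset n) 0ℓ
    SmallerAbove X Y = Y ∈𝕊 S × A ⊆ Y × Y ⊂ X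

    -- A ⊂-minimal member of 𝕊 above A is least because 𝕊 is closed under ∩.
    descend : ∀ X → Acc _⊂_ X → X ∈𝕊 S → A ⊆ X → ∃ (LeastAbove A)
    descend X (acc smaller) X∈𝕊 A⊆X
      with anySubset? {P = SmallerAbove X} (λ Y → (S Y ≟ᵇ true) ×-dec A ⊆? Y ×-dec Y ⊂? X)
    ... | yes (Y , Y∈𝕊 , A⊆Y , Y⊂X) = descend Y (smaller Y⊂X) Y∈𝕊 A⊆Y
    ... | no ∄smaller = X , X∈𝕊 , A⊆X , X⊆Z
      where
      X⊆Z : ∀ {Z} → Z ∈𝕊 S → A ⊆ Z → X ⊆ Z
      X⊆Z {Z} Z∈𝕊 A⊆Z {x} x∈X = decidable-stable (x ∈? Z) λ x∉Z →
        ∄smaller (X ∩ Z , ∩∈𝕊 X∈𝕊 Z∈𝕊 , (λ a∈A → x∈p∩q⁺ (A⊆X a∈A , A⊆Z a∈A)) ,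
                  p∩q⊆p X Z , x , x∈X , x∉Z ∘ p∩q⊆q X Z)

  σ : Subset n → Subset n
  σ A = proj₁ (leastAbove A)

  σ∈𝕊 : ∀ A → σ A ∈𝕊 S
  σ∈𝕊 A = proj₁ (proj₂ (leastAbove A))

  A⊆σA : ∀ A → A ⊆ σ A
  A⊆σA A = proj₁ (proj₂ (proj₂ (leastAbove A)))

  σ-least : ∀ {A Z} → Z ∈𝕊 S → A ⊆ Z → σ A ⊆ Z
  σ-least {A} = proj₂ (proj₂ (proj₂ (leastAbove A)))

  isClosureOperator : IsClosureOperator σ
  isClosureOperator = record
    { extensive  = A⊆σA
    ; monotone   = λ A B A⊆B → σ-least (σ∈𝕊 B) (A⊆σA B ∘ A⊆B)
    ; idempotent = λ A → ⊆-antisym (σ-least (σ∈𝕊 A) id) (A⊆σA (σ A))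
    }

  ∈𝕊⇔Closed : ∀ A → (A ∈𝕊 S ⇔ Closed σ A)
  ∈𝕊⇔Closed A = mk⇔ (λ A∈𝕊 → ⊆-antisym (σ-least A∈𝕊 id) (A⊆σA A))
                     (λ A-closed → subst (_∈𝕊 S) A-closed (σ∈𝕊 A))

IsClosedSetsOfSupersolvableClosure : ∀ {n} → Rel (Fin n) 0ℓ → SetSystem n → Set
IsClosedSetsOfSupersolvableClosure {n} _<_ S =
  Σ (Subset n → Subset n) λ σ →
    IsClosureOperator σ × SupersolvableClosure _<_ σ × (∀ A → (A ∈𝕊 S ⇔ Closed σ A))

module ConvexGeometry {n} {_<_ : Rel (Fin n) 0ℓ} (sto : IsStrictTotalOrder _≡_ _<_)
                      {S : SetSystem n} (cg : IsSupersolvableConvexGeometry _<_ S) where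
  open IsStrictTotalOrder sto using (compare; irrefl; trans; _<?_)
  open IsSupersolvableConvexGeometry cg

  -- Y is X ∩ (A ∪ ∁ P), reached by removing the elements of X ─ A in increasing order.
  prune : ∀ {P : Pred (Fin n) 0ℓ} → Decidable P → (∀ {x y} → y < x → P x → P y) →
          ∀ {A} X → Acc _⊂_ X → X ∈𝕊 S → A ∈𝕊 S →
          ∃ λ Y → Y ∈𝕊 S × Y ⊆ X × (∀ {x} → x ∈ X → x ∈ A ⊎ ¬ P x → x ∈ Y)
                                 × (∀ {x} → x ∈ Y → P x → x ∈ A)
  prune {P} P? P-down {A} X (acc smaller) X∈𝕊 A∈𝕊 with ⊆-or-minDiff sto X A
  ... | inj₁ X⊆A = X , X∈𝕊 , id , (λ x∈X _ → x∈X) , (λ x∈X _ → X⊆A x∈X)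
  ... | inj₂ (m , m-min@(m∈X , m∉A , m≼)) with P? m
  ...   | no ¬Pm = X , X∈𝕊 , id , (λ x∈X _ → x∈X) , P⊆A
    where
    P⊆A : ∀ {x} → x ∈ X → P x → x ∈ A
    P⊆A {x} x∈X Px = decidable-stable (x ∈? A) λ x∉A →
      ¬Pm ([ (λ { refl → Px }) , (λ m<x → P-down m<x Px) ]′ (m≼ x x∈X x∉A))
  ...   | yes Pm
    with prune P? P-down (X - m) (smaller (x∈p⇒p-x⊂p m∈X)) (remove-min X A X∈𝕊 A∈𝕊 m m-min) A∈𝕊
  ...     | Y , Y∈𝕊 , Y⊆X-m , keep , P∩Y⊆A =
    Y , Y∈𝕊 , p─q⊆p X ⁅ m ⁆ ∘ Y⊆X-m ,
    (λ x∈X x∈A⊎¬Px → keep (x∈p∧x≢y⇒x∈p-y x∈X (≢m x∈A⊎¬Px)) x∈A⊎¬Px) , P∩Y⊆A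
    where
    ≢m : ∀ {x} → x ∈ A ⊎ ¬ P x → x ≢ m
    ≢m x∈A⊎¬Px refl = [ m∉A , (λ ¬Pm → ¬Pm Pm) ]′ x∈A⊎¬Px

  ∩∈𝕊 : ∀ {A B} → A ∈𝕊 S → B ∈𝕊 S → (A ∩ B) ∈𝕊 S
  ∩∈𝕊 {A} {B} A∈𝕊 B∈𝕊 with prune {P = U} (λ _ → yes tt) (λ _ _ → tt) A (⊂-wellFounded A) A∈𝕊 B∈𝕊
  ... | Y , Y∈𝕊 , Y⊆A , keep , Y⊆B = subst (_∈𝕊 S) (⊆-antisym Y⊆A∩B A∩B⊆Y) Y∈𝕊
    where
    Y⊆A∩B : Y ⊆ A ∩ B
    Y⊆A∩B y∈Y = x∈p∩q⁺ (Y⊆A y∈Y , Y⊆B y∈Y tt)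
    A∩B⊆Y : A ∩ B ⊆ Y
    A∩B⊆Y x∈A∩B = keep (p∩q⊆p A B x∈A∩B) (inj₁ (p∩q⊆q A B x∈A∩B))

  separate : ∀ {A X e f} → A ∈𝕊 S → X ∈𝕊 S → A ⊆ X → e ∈ X → f ∉ A → f < e →
             ∃ λ Y → Y ∈𝕊 S × A ⊆ Y × e ∈ Y × f ∉ Y
  separate {X = X} {f = f} A∈𝕊 X∈𝕊 A⊆X e∈X f∉A f<e
    with prune {P = λ x → ¬ f < x} (λ x → ¬? (f <? x)) (λ y<x ¬f<x f<y → ¬f<x (trans f<y y<x))
               X (⊂-wellFounded X) X∈𝕊 A∈𝕊
  ... | Y , Y∈𝕊 , _ , keep , P∩Y⊆A =
    Y , Y∈𝕊 , (λ a∈A → keep (A⊆X a∈A) (inj₁ a∈A)) , keep e∈X (inj₂ λ ¬f<e → ¬f<e f<e) ,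
    (λ f∈Y → f∉A (P∩Y⊆A f∈Y (irrefl refl)))

  open Hull S full-mem ∩∈𝕊 public

  σ-supersolvable : SupersolvableClosure _<_ σ
  σ-supersolvable A A-closed e _ f f∈σ[A∪e] f∉A∪e with compare e f
  ... | tri< e<f _ _ = e<f
  ... | tri≈ _ refl _ = ⊥-elim (f∉A∪e (q⊆p∪q A ⁅ f ⁆ (x∈⁅x⁆ f)))
  ... | tri> _ _ f<e with separate A∈𝕊 (σ∈𝕊 (A ∪ ⁅ e ⁆)) A⊆σ[A∪e] e∈σ[A∪e] (f∉A∪e ∘ p⊆p∪q ⁅ e ⁆) f<e
    where
    A∈𝕊 : A ∈𝕊 S
    A∈𝕊 = subst (_∈𝕊 S) A-closed (σ∈𝕊 A)
    A⊆σ[A∪e] : A ⊆ σ (A ∪ ⁅ e ⁆)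
    A⊆σ[A∪e] = A⊆σA (A ∪ ⁅ e ⁆) ∘ p⊆p∪q ⁅ e ⁆
    e∈σ[A∪e] : e ∈ σ (A ∪ ⁅ e ⁆)
    e∈σ[A∪e] = A⊆σA (A ∪ ⁅ e ⁆) (q⊆p∪q A ⁅ e ⁆ (x∈⁅x⁆ e))
  ...   | Y , Y∈𝕊 , A⊆Y , e∈Y , f∉Y =
    ⊥-elim (f∉Y (σ-least Y∈𝕊 (p⊆r∧x∈r⇒p∪⁅x⁆⊆r A⊆Y e∈Y) f∈σ[A∪e]))

  isClosedSetsOfSupersolvableClosure : IsClosedSetsOfSupersolvableClosure _<_ S
  isClosedSetsOfSupersolvableClosure = σ , isClosureOperator , σ-supersolvable , ∈𝕊⇔Closed

module SupersolvableClosureOperator {n} {_<_ : Rel (Fin n) 0ℓ} (sto : IsStrictTotalOrder _≡_ _<_)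
         {σ : Subset n → Subset n} (cl : IsClosureOperator σ) (ss : SupersolvableClosure _<_ σ) where
  open IsStrictTotalOrder sto using (irrefl; asym)
  open IsClosureOperator cl

  σ⊆closed : ∀ {A B} → Closed σ A → B ⊆ A → σ B ⊆ A
  σ⊆closed {A} {B} A-closed B⊆A x∈σB = subst (_ ∈_) A-closed (monotone B A B⊆A x∈σB)

  ⊤-closed : Closed σ ⊤
  ⊤-closed = ⊆-antisym ⊆⊤ (extensive ⊤)

  ∩-closed : ∀ {A B} → Closed σ A → Closed σ B → Closed σ (A ∩ B)
  ∩-closed {A} {B} A-closed B-closed = ⊆-antisym
    (λ x∈ → x∈p∩q⁺ (σ⊆closed A-closed (p∩q⊆p A B) x∈ , σ⊆closed B-closed (p∩q⊆q A B) x∈))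
    (extensive (A ∩ B))

  grow : ∀ {A e} D → Acc _⊃_ D → Closed σ A → Closed σ D → D ⊆ A →
         IsMinDiff _<_ A D e → Closed σ (A - e)
  grow {A} {e} D (acc larger) A-closed D-closed D⊆A (e∈A , e∉D , e≼) with ⊆-or-minDiff sto (A - e) D
  ... | inj₁ A-e⊆D = subst (Closed σ) (⊆-antisym D⊆A-e A-e⊆D) D-closed
    where
    D⊆A-e : D ⊆ A - e
    D⊆A-e x∈D = x∈p∧x≢y⇒x∈p-y (D⊆A x∈D) (λ { refl → e∉D x∈D })
  ... | inj₂ (x , x∈A-e , x∉D , _) =
    grow D′ (larger D⊂D′) A-closed (idempotent (D ∪ ⁅ x ⁆))
         (σ⊆closed A-closed (p⊆r∧x∈r⇒p∪⁅x⁆⊆r D⊆A x∈A))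
         (e∈A , e∉D′ , λ y y∈A y∉D′ → e≼ y y∈A (y∉D′ ∘ D⊆D′))
    where
    x∈A : x ∈ A
    x∈A = p─q⊆p A ⁅ e ⁆ x∈A-e
    D′ : Subset n
    D′ = σ (D ∪ ⁅ x ⁆)
    D⊆D′ : D ⊆ D′
    D⊆D′ = extensive (D ∪ ⁅ x ⁆) ∘ p⊆p∪q ⁅ x ⁆
    D⊂D′ : D ⊂ D′
    D⊂D′ = D⊆D′ , x , extensive (D ∪ ⁅ x ⁆) (q⊆p∪q D ⁅ x ⁆ (x∈⁅x⁆ x)) , x∉D
    e∉D′ : e ∉ D′
    e∉D′ e∈D′ with ss D D-closed x x∉D e e∈D′ (x∉p∧x≢y⇒x∉p∪⁅y⁆ e∉D (x∈p-y⇒x≢y x∈A-e ∘ sym))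
                  | e≼ x x∈A x∉D
    ... | x<e | inj₁ refl = irrefl refl x<e
    ... | x<e | inj₂ e<x = asym x<e e<x

  remove-min-closed : ∀ {A B e} → Closed σ A → Closed σ B → IsMinDiff _<_ A B e → Closed σ (A - e)
  remove-min-closed {A} {B} A-closed B-closed (e∈A , e∉B , e≼) =
    grow (A ∩ B) (⊃-wellFounded (A ∩ B)) A-closed (∩-closed A-closed B-closed) (p∩q⊆p A B)
         (e∈A , e∉B ∘ p∩q⊆q A B , λ y y∈A y∉A∩B → e≼ y y∈A (λ y∈B → y∉A∩B (x∈p∩q⁺ (y∈A , y∈B))))

  isSupersolvableConvexGeometry : ∀ {S} → (∀ A → (A ∈𝕊 S ⇔ Closed σ A)) →
                                  IsSupersolvableConvexGeometry _<_ S
  isSupersolvableConvexGeometry ∈𝕊⇔Closed = record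
    { full-mem   = Equivalence.from (∈𝕊⇔Closed ⊤) ⊤-closed
    ; remove-min = λ A B A∈𝕊 B∈𝕊 e e-min → Equivalence.from (∈𝕊⇔Closed (A - e))
        (remove-min-closed (Equivalence.to (∈𝕊⇔Closed A) A∈𝕊)
                           (Equivalence.to (∈𝕊⇔Closed B) B∈𝕊) e-min)
    }

proposition3p19 : (n : ℕ) (_<_ : Rel (Fin n) 0ℓ) → IsStrictTotalOrder _≡_ _<_ →
    (S : SetSystem n) →
    IsSupersolvableConvexGeometry _<_ S ⇔
      Σ (Subset n → Subset n) (λ σ →
        IsClosureOperator σ × SupersolvableClosure _<_ σ ×
        (∀ A → (A ∈𝕊 S ⇔ Closed σ A)))
proposition3p19 n _<_ sto S = mk⇔
  (ConvexGeometry.isClosedSetsOfSupersolvableClosure sto)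
  (λ (σ , cl , ss , ∈𝕊⇔Closed) →
    SupersolvableClosureOperator.isSupersolvableConvexGeometry sto cl ss ∈𝕊⇔Closed)
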